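{- Let $G$ be a finite graph and define $\ell:E(G)\to\mathbb{N}$ by $\ell(\{u,v\})=\max\{\deg(u),\deg(v)\}+1$. Then for every list assignment $L$ on $E(G)$ of size $\ell$, Alice has a winning strategy in the game $\mathcal{G}(M(G))_L$, in which both players color edges of $G$ from their lists avoiding monochromatic cycles.
   Context: $M(G)$ is the graphic (cycle) matroid of $G$. A list assignment $L:E(G)\to\mathcal{P}(\mathbb{N})$ has size $\ell$ if $|L(e)|=\ell(e)$ for all $e$. The game $\mathcal{G}(M(G))_L$: Alice and Bob alternately (Alice first) color an uncolored edge $e$ with one color from $L(e)$, such that at every moment each color class contains no cycle; Alice wins if all edges get colored, Bob wins if a partial coloring is reached that cannot be extended. -}

module Defs where

open import Data.Nat using (ℕ; zero; suc; _⊔_; _≤_)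
open import Data.Fin using (Fin; zero; suc; inject₁; fromℕ; _≟_)
open import Data.Fin.Properties using () renaming (_≟_ to _≟ᶠ_)
open import Data.Product using (Σ; ∃; _×_; _,_; proj₁; proj₂; swap)
open import Data.Sum using (_⊎_)
open import Data.Bool using (Bool; true; false; _∨_; if_then_else_)
open import Data.Maybe using (Maybe; just; nothing)
open import Data.List using (List; length; filterᵇ; allFin)
open import Data.List.Membership.Propositional using (_∈_)
open import Relation.Nullary using (¬_)
open import Relation.Nullary.Decidable using (⌊_⌋)
open import Relation.Binary.PropositionalEquality using (_≡_; _≢_)
open import Function.Definitions using (Injective)

record Graph : Set where
  field
    n     : ℕ
    m     : ℕ
    ends  : Fin m → Fin n × Fin n
    loopless : ∀ e → proj₁ (ends e) ≢ proj₂ (ends e)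
    simple   : ∀ e f → (ends e ≡ ends f ⊎ ends e ≡ swap (ends f)) → e ≡ f

module _ (G : Graph) where
  open Graph G

  Vertex : Set
  Vertex = Fin n

  Edge : Set
  Edge = Fin m

  Joins : Edge → Vertex → Vertex → Set
  Joins e x y = ends e ≡ (x , y) ⊎ ends e ≡ (y , x)

  incident : Vertex → Edge → Bool
  incident v e = ⌊ proj₁ (ends e) ≟ v ⌋ ∨ ⌊ proj₂ (ends e) ≟ v ⌋

  deg : Vertex → ℕ
  deg v = length (filterᵇ (incident v) (allFin m))

  ℓ : Edge → ℕ
  ℓ e = suc (deg (proj₁ (ends e)) ⊔ deg (proj₂ (ends e)))

  -- A cycle in the edge set P: closed walk w 0, e 0, w 1, ..., e (k-1), w k = w 0,
  -- with k ≥ 1, pairwise distinct edges and pairwise distinct vertices w 0..w (k-1).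
  record Cycle (P : Edge → Set) : Set where
    field
      k      : ℕ
      k≥1    : 1 ≤ k
      w      : Fin (suc k) → Vertex
      es     : Fin k → Edge
      closed : w (fromℕ k) ≡ w zero
      joins  : ∀ i → Joins (es i) (w (inject₁ i)) (w (suc i))
      inP    : ∀ i → P (es i)
      es-inj : Injective _≡_ _≡_ es
      w-inj  : Injective _≡_ _≡_ (λ (i : Fin k) → w (inject₁ i))

  Acyclic : (Edge → Set) → Set
  Acyclic P = ¬ Cycle P

  -- partial colourings: nothing = uncoloured
  Colouring : Set
  Colouring = Edge → Maybe ℕ

  Proper : Colouring → Set
  Proper c = ∀ (col : ℕ) → Acyclic (λ e → c e ≡ just col)

  _[_≔_] : Colouring → Edge → ℕ → Colouring
  (c [ e ≔ col ]) f = if ⌊ f ≟ e ⌋ then just col else c f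

  Complete : Colouring → Set
  Complete c = ∀ e → ∃ λ col → c e ≡ just col

  Legal : (Edge → List ℕ) → Colouring → Edge → ℕ → Set
  Legal L c e col = (c e ≡ nothing) × (col ∈ L e) × Proper (c [ e ≔ col ])

  data Player : Set where
    alice bob : Player

  -- AliceWins L p c: Alice has a winning strategy from position c with p to move.
  -- Alice wins once every edge is coloured; Bob wins if an uncoloured edge remains
  -- but no legal move exists.
  data AliceWins (L : Edge → List ℕ) : Player → Colouring → Set where
    done      : ∀ {p c} → Complete c → AliceWins L p c
    aliceMove : ∀ {c} e col → Legal L c e col →
                AliceWins L bob (c [ e ≔ col ]) → AliceWins L alice c
    bobMove   : ∀ {c} → (∃ λ e → ∃ λ col → Legal L c e col) →
                (∀ e col → Legal L c e col → AliceWins L alice (c [ e ≔ col ])) →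
                AliceWins L bob c

  empty : Colouring
  empty _ = nothing

-- Whenever an edge e = uv is uncoloured, at most deg u colours appear on the
-- edges at u, while |L(e)| > deg u; so some colour of L(e) is missing at u.
-- Giving e that colour creates no monochromatic cycle, because a cycle through
-- e leaves u along a second edge, which would have the same colour. Hence
-- neither player can ever get stuck, and Alice wins by induction on the number
-- of uncoloured edges.
module Submission where

open import Defs
open import Data.Nat using (ℕ)
open import Data.Fin using (Fin)
open import Data.List using (List; length)
open import Data.List.Relation.Unary.Unique.Propositional using (Unique)
open import Relation.Binary.PropositionalEquality using (_≡_)

open import Data.Nat as ℕ using (zero; suc; s≤s; _≤_; _<_)
open import Data.Nat.Properties using (≤-pred; ≤-trans; m≤m⊔n)
open import Data.Nat.Induction using (<-wellFounded)
open import Data.Fin using (zero; suc; inject₁; fromℕ; fromℕ<) renaming (_≟_ to _≟ᶠ_)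
open import Data.Fin.Properties using (any?)
open import Data.Fin.Relation.Unary.Top using (view; ‵fromℕ; ‵inject₁)
open import Data.Fin.Subset using (Subset; ∣_∣) renaming (_∈_ to _∈ₛ_; _⊂_ to _⊂ₛ_)
open import Data.Fin.Subset.Properties using (p⊂q⇒∣p∣<∣q∣)
open import Data.Vec using (tabulate)
open import Data.Vec.Properties using (lookup∘tabulate; lookup⇒[]=; []=⇒lookup)
open import Data.Product using (∃; _×_; _,_; proj₁; proj₂)
open import Data.Sum using (_⊎_; inj₁; inj₂)
open import Data.Bool using (true; T)
open import Data.Maybe using (Maybe; just; nothing; is-nothing)
open import Data.Maybe.Properties using (≡-dec)
import Data.Maybe.Relation.Unary.Any as MaybeAny
open import Data.List using (_∷_; _++_; filterᵇ; allFin; mapMaybe)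
open import Data.List.Properties using (length-++-sucʳ; length-mapMaybe)
open import Data.List.Membership.Propositional using (_∈_; _∉_)
open import Data.List.Membership.Propositional.Properties
  using (∈-∃++; ∈-++⁻; ∈-++⁺ˡ; ∈-++⁺ʳ; ∈-filter⁺; ∈-allFin)
import Data.List.Membership.DecPropositional as DecMembership
import Data.List.Relation.Unary.All as All
open import Data.List.Relation.Unary.AllPairs using (_∷_)
import Data.List.Relation.Unary.Any as Any
open import Data.List.Relation.Unary.Any using (here; there)
open import Data.List.Relation.Unary.Any.Properties using (map⁺; mapMaybe⁺)
open import Function using (_∘_)
open import Induction.WellFounded using (Acc; acc)
open import Relation.Binary.Definitions using (DecidableEquality)
open import Relation.Binary.PropositionalEquality using (refl; sym; trans; cong; subst; _≢_; module ≡-Reasoning)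
open import Relation.Nullary using (yes; no; contradiction)
open import Relation.Nullary.Decidable using (T?)

module _ {A : Set} (_≟_ : DecidableEquality A) where
  open DecMembership _≟_ using (_∈?_)

  ∉-++-∷ : ∀ ys₁ {ys₂} {x z : A} → z ≢ x → z ∉ ys₁ ++ ys₂ → z ∉ ys₁ ++ x ∷ ys₂
  ∉-++-∷ ys₁ z≢x z∉ z∈ with ∈-++⁻ ys₁ z∈
  ... | inj₁ z∈ys₁         = z∉ (∈-++⁺ˡ z∈ys₁)
  ... | inj₂ (here z≡x)    = z≢x z≡x
  ... | inj₂ (there z∈ys₂) = z∉ (∈-++⁺ʳ ys₁ z∈ys₂)

  ∃∉-of-longer-Unique : ∀ {xs ys : List A} → Unique xs → length ys < length xs →
                        ∃ λ x → x ∈ xs × x ∉ ys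
  ∃∉-of-longer-Unique {x ∷ xs} {ys} (x≢xs ∷ xs-unique) ys<xs with x ∈? ys
  ... | no x∉ys = x , here refl , x∉ys
  ... | yes x∈ys
    with ys₁ , ys₂ , refl ← ∈-∃++ x∈ys
    with z , z∈xs , z∉ ← ∃∉-of-longer-Unique xs-unique
           (subst (_≤ length xs) (length-++-sucʳ ys₁ x ys₂) (≤-pred ys<xs))
    = z , there z∈xs , ∉-++-∷ ys₁ (λ z≡x → All.lookup x≢xs z∈xs (sym z≡x)) z∉

∈-mapMaybe⁺ : ∀ {A B : Set} (f : A → Maybe B) {x xs y} → x ∈ xs → f x ≡ just y →
              y ∈ mapMaybe f xs
∈-mapMaybe⁺ f {xs = xs} x∈xs fx≡y =
  mapMaybe⁺ f xs (map⁺ (Any.map (λ { refl → subst (MaybeAny.Any (_ ≡_)) (sym fx≡y) (MaybeAny.just refl) })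
                                x∈xs))

is-nothing⇒≡nothing : ∀ {A : Set} {m : Maybe A} → is-nothing m ≡ true → m ≡ nothing
is-nothing⇒≡nothing {m = nothing} _ = refl

module _ {A : Set} {k : ℕ} (w : Fin (suc (suc k)) → A) (closed : w (fromℕ (suc k)) ≡ w zero) where

  closed-walk-step-from : ∀ x → ∃ λ j → w (inject₁ j) ≡ w x
  closed-walk-step-from x with view x
  ... | ‵fromℕ     = zero , sym closed
  ... | ‵inject₁ j = j , refl

  closed-walk-step-to : ∀ x → ∃ λ j → w (suc j) ≡ w x
  closed-walk-step-to zero    = fromℕ k , closed
  closed-walk-step-to (suc j) = j , refl

module _ (G : Graph) where
  open Graph G

  Endpoint : Vertex G → Edge G → Set
  Endpoint u e = ∃ λ v → Joins G e u v

  first-endpoint : ∀ e → Endpoint (proj₁ (ends e)) e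
  first-endpoint e = proj₂ (ends e) , inj₁ refl

  joins-sym : ∀ {e x y} → Joins G e x y → Joins G e y x
  joins-sym (inj₁ e≡xy) = inj₂ e≡xy
  joins-sym (inj₂ e≡yx) = inj₁ e≡yx

  joins-irreflexive : ∀ {e x y} → Joins G e x y → x ≢ y
  joins-irreflexive {e} (inj₁ e≡xy) x≡y =
    loopless e (trans (cong proj₁ e≡xy) (trans x≡y (sym (cong proj₂ e≡xy))))
  joins-irreflexive {e} (inj₂ e≡yx) x≡y =
    loopless e (trans (cong proj₁ e≡yx) (trans (sym x≡y) (sym (cong proj₂ e≡yx))))

  endpoint-of-joins : ∀ {e x y u} → Joins G e x y → Endpoint u e → u ≡ x ⊎ u ≡ y
  endpoint-of-joins (inj₁ e≡xy) (_ , inj₁ e≡uv) = inj₁ (cong proj₁ (trans (sym e≡uv) e≡xy))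
  endpoint-of-joins (inj₁ e≡xy) (_ , inj₂ e≡vu) = inj₂ (cong proj₂ (trans (sym e≡vu) e≡xy))
  endpoint-of-joins (inj₂ e≡yx) (_ , inj₁ e≡uv) = inj₂ (cong proj₁ (trans (sym e≡uv) e≡yx))
  endpoint-of-joins (inj₂ e≡yx) (_ , inj₂ e≡vu) = inj₁ (cong proj₂ (trans (sym e≡vu) e≡yx))

  endpoint⇒incident : ∀ {u e} → Endpoint u e → T (incident G u e)
  endpoint⇒incident {u} {e} (_ , inj₁ e≡uv) with proj₁ (ends e) ≟ᶠ u
  ... | yes _   = _
  ... | no e₁≢u = contradiction (cong proj₁ e≡uv) e₁≢u
  endpoint⇒incident {u} {e} (_ , inj₂ e≡vu) with proj₁ (ends e) ≟ᶠ u | proj₂ (ends e) ≟ᶠ u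
  ... | yes _ | _       = _
  ... | no _  | yes _   = _
  ... | no _  | no e₂≢u = contradiction (cong proj₂ e≡vu) e₂≢u

  closed-walk-shares-endpoint :
    ∀ {k} (w : Fin (suc k) → Vertex G) (es : Fin k → Edge G) → w (fromℕ k) ≡ w zero →
    (∀ i → Joins G (es i) (w (inject₁ i)) (w (suc i))) →
    ∀ i {u} → Endpoint u (es i) → ∃ λ j → j ≢ i × Endpoint u (es j)
  closed-walk-shares-endpoint {zero} _ _ _ _ ()
  closed-walk-shares-endpoint {suc k} w es closed joins i u∈esᵢ
    with endpoint-of-joins (joins i) u∈esᵢ
  ... | inj₁ refl
    with j , wⱼ₊₁≡wᵢ ← closed-walk-step-to w closed (inject₁ i)
    = j , (λ { refl → joins-irreflexive (joins i) (sym wⱼ₊₁≡wᵢ) })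
        , w (inject₁ j) , joins-sym (subst (Joins G (es j) (w (inject₁ j))) wⱼ₊₁≡wᵢ (joins j))
  ... | inj₂ refl
    with j , wⱼ≡wᵢ₊₁ ← closed-walk-step-from w closed (suc i)
    = j , (λ { refl → joins-irreflexive (joins i) wⱼ≡wᵢ₊₁ })
        , w (suc j) , subst (λ x → Joins G (es j) x (w (suc j))) wⱼ≡wᵢ₊₁ (joins j)

  cycle-within : ∀ {P Q} (C : Cycle G P) → (∀ i → Q (Cycle.es C i)) → Cycle G Q
  cycle-within C Q-es = record { C′ hiding (inP) ; inP = Q-es }
    where module C′ = Cycle C

  recolour-same : ∀ c e col → _[_≔_] G c e col e ≡ just col
  recolour-same c e col with e ≟ᶠ e
  ... | yes _   = refl
  ... | no e≢e = contradiction refl e≢e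

  recolour-other : ∀ c e col {f} → f ≢ e → _[_≔_] G c e col f ≡ c f
  recolour-other c e col {f} f≢e with f ≟ᶠ e
  ... | yes f≡e = contradiction f≡e f≢e
  ... | no _    = refl

  coloursAt : Colouring G → Vertex G → List ℕ
  coloursAt c u = mapMaybe c (filterᵇ (incident G u) (allFin m))

  ∈-coloursAt : ∀ {c u f col} → Endpoint u f → c f ≡ just col → col ∈ coloursAt c u
  ∈-coloursAt {c} {u} {f} u∈f =
    ∈-mapMaybe⁺ c (∈-filter⁺ (T? ∘ incident G u) (∈-allFin f) (endpoint⇒incident u∈f))

  length-coloursAt : ∀ c u → length (coloursAt c u) ≤ deg G u
  length-coloursAt c u = length-mapMaybe c (filterᵇ (incident G u) (allFin m))

  coloursAt-first-endpoint<ℓ : ∀ c e → length (coloursAt c (proj₁ (ends e))) < ℓ G e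
  coloursAt-first-endpoint<ℓ c e =
    s≤s (≤-trans (length-coloursAt c (proj₁ (ends e)))
                 (m≤m⊔n (deg G (proj₁ (ends e))) (deg G (proj₂ (ends e)))))

  recolour-proper : ∀ {c e col u} → Proper G c → Endpoint u e → col ∉ coloursAt c u →
                    Proper G (_[_≔_] G c e col)
  recolour-proper {c} {e} {col} {u} proper u∈e col∉ d C with any? (λ i → Cycle.es C i ≟ᶠ e)
  ... | no e∉C = proper d (cycle-within C λ i →
                   trans (sym (recolour-other c e col (λ esᵢ≡e → e∉C (i , esᵢ≡e)))) (Cycle.inP C i))
  ... | yes (i , esᵢ≡e)
    with j , j≢i , u∈esⱼ ← closed-walk-shares-endpoint (Cycle.w C) (Cycle.es C) (Cycle.closed C)
                             (Cycle.joins C) i (subst (Endpoint u) (sym esᵢ≡e) u∈e)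
    = col∉ (∈-coloursAt u∈esⱼ c-esⱼ≡col)
    where
    open ≡-Reasoning
    esⱼ≢e : Cycle.es C j ≢ e
    esⱼ≢e esⱼ≡e = j≢i (Cycle.es-inj C (trans esⱼ≡e (sym esᵢ≡e)))
    just-d≡just-col : just d ≡ just col
    just-d≡just-col = begin
      just d                         ≡⟨ sym (Cycle.inP C i) ⟩
      _[_≔_] G c e col (Cycle.es C i) ≡⟨ cong (_[_≔_] G c e col) esᵢ≡e ⟩
      _[_≔_] G c e col e             ≡⟨ recolour-same c e col ⟩
      just col                       ∎
    c-esⱼ≡col : c (Cycle.es C j) ≡ just col
    c-esⱼ≡col = begin
      c (Cycle.es C j)                ≡⟨ sym (recolour-other c e col esⱼ≢e) ⟩
      _[_≔_] G c e col (Cycle.es C j) ≡⟨ Cycle.inP C j ⟩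
      just d                          ≡⟨ just-d≡just-col ⟩
      just col                        ∎

  empty-proper : Proper G (empty G)
  empty-proper d C = contradiction (Cycle.inP C (fromℕ< (Cycle.k≥1 C))) λ ()

  complete-or-uncoloured : (c : Colouring G) → Complete G c ⊎ ∃ λ e → c e ≡ nothing
  complete-or-uncoloured c with any? (λ e → ≡-dec ℕ._≟_ (c e) nothing)
  ... | yes uncoloured = inj₂ uncoloured
  ... | no all-coloured = inj₁ complete
    where
    complete : Complete G c
    complete e with c e in ce
    ... | just col = col , refl
    ... | nothing  = contradiction (e , ce) all-coloured

  uncoloured : Colouring G → Subset m
  uncoloured c = tabulate (is-nothing ∘ c)

  ∈-uncoloured⁺ : ∀ {c e} → c e ≡ nothing → e ∈ₛ uncoloured c
  ∈-uncoloured⁺ {c} {e} ce = lookup⇒[]= e _ (trans (lookup∘tabulate _ e) (cong is-nothing ce))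

  ∈-uncoloured⁻ : ∀ {c e} → e ∈ₛ uncoloured c → c e ≡ nothing
  ∈-uncoloured⁻ {c} {e} e∈ = is-nothing⇒≡nothing (trans (sym (lookup∘tabulate _ e)) ([]=⇒lookup e∈))

  recolour-uncoloured-⊂ : ∀ {c e} col → c e ≡ nothing →
                          uncoloured (_[_≔_] G c e col) ⊂ₛ uncoloured c
  recolour-uncoloured-⊂ {c} {e} col ce =
    (λ f∈ → ∈-uncoloured⁺ (still-uncoloured (∈-uncoloured⁻ f∈))) , e , ∈-uncoloured⁺ ce ,
    λ e∈ → contradiction (trans (sym (recolour-same c e col)) (∈-uncoloured⁻ e∈)) λ ()
    where
    still-uncoloured : ∀ {f} → _[_≔_] G c e col f ≡ nothing → c f ≡ nothing
    still-uncoloured {f} c′f with f ≟ᶠ e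
    ... | yes refl = ce
    ... | no _     = c′f

module _ (G : Graph) (L : Edge G → List ℕ)
         (L-unique : ∀ e → Unique (L e)) (L-size : ∀ e → length (L e) ≡ ℓ G e) where

  legal-move : ∀ {c e} → Proper G c → c e ≡ nothing → ∃ λ col → Legal G L c e col
  legal-move {c} {e} proper ce
    with col , col∈L , col∉ ← ∃∉-of-longer-Unique ℕ._≟_ (L-unique e)
           (subst (_ <_) (sym (L-size e)) (coloursAt-first-endpoint<ℓ G c e))
    = col , ce , col∈L , recolour-proper G proper (first-endpoint G e) col∉

  alice-wins : ∀ {c} → Proper G c → Acc _<_ ∣ uncoloured G c ∣ → ∀ p → AliceWins G L p c
  alice-wins {c} proper (acc smaller) p with complete-or-uncoloured G c
  ... | inj₁ complete = done complete
  ... | inj₂ (e , ce) = play p (legal-move proper ce)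
    where
    after : ∀ {e col} → Legal G L c e col → ∀ p → AliceWins G L p (_[_≔_] G c e col)
    after {col = col} (ce , _ , proper′) =
      alice-wins proper′ (smaller (p⊂q⇒∣p∣<∣q∣ (recolour-uncoloured-⊂ G col ce)))
    play : ∀ p → (∃ λ col → Legal G L c e col) → AliceWins G L p c
    play alice (col , legal) = aliceMove e col legal (after legal bob)
    play bob move = bobMove (e , move) (λ _ _ legal → after legal alice)

corollary12 : (G : Graph) (L : Fin (Graph.m G) → List ℕ) →
    (∀ e → Unique (L e)) → (∀ e → length (L e) ≡ ℓ G e) →
    AliceWins G L alice (empty G)
corollary12 G L L-unique L-size =
  alice-wins G L L-unique L-size (empty-proper G) (<-wellFounded _) alice
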